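{- Let $T$ be a tree and $H$ a graph. Let $V\subseteq V(T(H))$ and let $V_1,V_2\subseteq V$ with $V_1\cup V_2=V$ and $V_1\cap V_2=\emptyset$ (one of them possibly empty). Assume that there are two vertices $u,v$ of $T$ and a set $\{1,\dots,t\}$ of vertices of $H$ such that for each $i\in\{1,\dots,t\}$ the role of $u^i$ differs from the role of $v^i$. Then $T(H)$ has a matching of size $t$ such that the two ends of each of its edges have different roles.
   Context: For a tree $T$ and a graph $H$ with $V(H)=\{1,\dots,m\}$, $T(H)$ is the disjoint union of copies $H^w$ ($w\in V(T)$) of $H$, with $w^i$ the copy of $i$ in $H^w$, plus the edges $\{w^i,z^i\}$ for every $i$ and every edge $\{w,z\}$ of $T$. With respect to $V_1,V_2$, each vertex of $T(H)$ has one of three roles: belonging to $V_1$, belonging to $V_2$, or belonging to $V(T(H))\setminus V$. -}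

module Defs where

open import Data.Nat using (ℕ; _≤_)
open import Data.Fin using (Fin)
open import Data.Bool using (Bool; true; false; if_then_else_)
open import Data.List using (List; []; _∷_; length)
open import Data.List.Relation.Unary.Unique.Propositional using (Unique)
open import Data.Product using (Σ; _×_; _,_; proj₁; proj₂)
open import Data.Sum using (_⊎_)
open import Data.Empty using (⊥)
open import Relation.Nullary using (¬_)
open import Relation.Binary.PropositionalEquality using (_≡_)

record SimpleGraph (n : ℕ) : Set₁ where
  field
    Adj    : Fin n → Fin n → Set
    sym    : ∀ {x y} → Adj x y → Adj y x
    irrefl : ∀ {x} → ¬ Adj x x
open SimpleGraph public

module _ {n : ℕ} (G : SimpleGraph n) where
  data Walk : Fin n → Fin n → Set where
    nil  : ∀ {x} → Walk x x
    cons : ∀ {x y z} → Adj G x y → Walk y z → Walk x z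

  support : ∀ {x y} → Walk x y → List (Fin n)
  support {x} nil = x ∷ []
  support {x} (cons _ w) = x ∷ support w

  walkLength : ∀ {x y} → Walk x y → ℕ
  walkLength nil = 0
  walkLength (cons _ w) = Data.Nat.suc (walkLength w)

  Connected : Set
  Connected = ∀ x y → Walk x y

  record Cycle : Set where
    field
      start end : Fin n
      path      : Walk start end
      distinct  : Unique (support path)
      long      : 2 ≤ walkLength path
      closing   : Adj G end start

  Acyclic : Set
  Acyclic = ¬ Cycle

  IsTree : Set
  IsTree = Connected × Acyclic

-- The graph T(H): vertex (w , i) is w^i.
TH-Vertex : ℕ → ℕ → Set
TH-Vertex n m = Fin n × Fin m

TH-Adj : ∀ {n m} → SimpleGraph n → SimpleGraph m → TH-Vertex n m → TH-Vertex n m → Set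
TH-Adj T H (w , i) (z , j) = (w ≡ z × Adj H i j) ⊎ (i ≡ j × Adj T w z)

data Role : Set where
  inV1 inV2 outside : Role

role : ∀ {n m} → (V₁ V₂ : TH-Vertex n m → Bool) → TH-Vertex n m → Role
role V₁ V₂ x = if V₁ x then inV1 else (if V₂ x then inV2 else outside)

record Matching {n m} (T : SimpleGraph n) (H : SimpleGraph m) (t : ℕ) : Set where
  field
    edge     : Fin t → TH-Vertex n m × TH-Vertex n m
    isEdge   : ∀ k → TH-Adj T H (proj₁ (edge k)) (proj₂ (edge k))
    disjoint : ∀ k l → ¬ k ≡ l →
               (¬ proj₁ (edge k) ≡ proj₁ (edge l)) × (¬ proj₁ (edge k) ≡ proj₂ (edge l)) ×
               (¬ proj₂ (edge k) ≡ proj₁ (edge l)) × (¬ proj₂ (edge k) ≡ proj₂ (edge l))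
open Matching public

module Submission where

-- Only the connectivity of T matters.  For a fixed layer i = g k,
-- the roles of the vertices w^i (w ∈ V(T)) form a colouring of T; since the
-- colours of u and v differ and T contains a walk from u to v, some edge
-- {a , b} of T on that walk already has differently coloured ends.  Lifting
-- this edge to the copy {a^i , b^i} gives one edge of T(H) per layer.  Edges
-- lying in distinct layers g k ≠ g l are vertex-disjoint, and g is injective,
-- so the t lifted edges form a matching of size t.

open import Defs
open import Data.Nat using (ℕ)
open import Data.Fin using (Fin)
open import Data.Bool using (Bool; false; _∧_; _∨_)
open import Data.Product using (Σ; _,_; proj₁; proj₂)
open import Data.Sum using (inj₂)
open import Data.Empty using (⊥-elim)
open import Relation.Nullary using (¬_; yes; no)
open import Relation.Binary.Definitions using (DecidableEquality)
open import Relation.Binary.PropositionalEquality using (_≡_; refl; trans; cong)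
open import Function.Definitions using (Injective)
open import Function using (_∘_)

_≟-role_ : DecidableEquality Role
inV1    ≟-role inV1    = yes refl
inV1    ≟-role inV2    = no λ ()
inV1    ≟-role outside = no λ ()
inV2    ≟-role inV1    = no λ ()
inV2    ≟-role inV2    = yes refl
inV2    ≟-role outside = no λ ()
outside ≟-role inV1    = no λ ()
outside ≟-role inV2    = no λ ()
outside ≟-role outside = yes refl

record BichromaticEdge {n} (G : SimpleGraph n) {A : Set} (c : Fin n → A) : Set where
  constructor bichromatic
  field
    from to  : Fin n
    adjacent : Adj G from to
    differ   : ¬ c from ≡ c to

bichromaticEdgeOnWalk : ∀ {n} (G : SimpleGraph n) {A : Set} → DecidableEquality A →
  (c : Fin n → A) → ∀ {x y} → Walk G x y → ¬ c x ≡ c y → BichromaticEdge G c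
bichromaticEdgeOnWalk G _≟_ c nil cx≢cx = ⊥-elim (cx≢cx refl)
bichromaticEdgeOnWalk G _≟_ c {x} (cons {y = z} xz rest) cx≢cy with c x ≟ c z
... | yes cx≡cz = bichromaticEdgeOnWalk G _≟_ c rest (λ cz≡cy → cx≢cy (trans cx≡cz cz≡cy))
... | no  cx≢cz = bichromatic x z xz cx≢cz

layeredMatching : ∀ {n m t} (T : SimpleGraph n) (H : SimpleGraph m) →
  (g : Fin t → Fin m) → Injective _≡_ _≡_ g →
  (a b : Fin t → Fin n) → (∀ k → Adj T (a k) (b k)) → Matching T H t
layeredMatching T H g g-injective a b ab = record
  { edge     = λ k → (a k , g k) , (b k , g k)
  ; isEdge   = λ k → inj₂ (refl , ab k)
  ; disjoint = λ k l k≢l → apart k≢l , apart k≢l , apart k≢l , apart k≢l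
  }
  where
  apart : ∀ {k l} → ¬ k ≡ l → ∀ {w z} → ¬ (w , g k) ≡ (z , g l)
  apart k≢l same = k≢l (g-injective (cong proj₂ same))

lemma1 : ∀ {n m : ℕ} (T : SimpleGraph n) (H : SimpleGraph m) → IsTree T →
    (V V₁ V₂ : TH-Vertex n m → Bool) →
    (∀ x → (V₁ x ∨ V₂ x) ≡ V x) →
    (∀ x → (V₁ x ∧ V₂ x) ≡ false) →
    (u v : Fin n) (t : ℕ) (g : Fin t → Fin m) → Injective _≡_ _≡_ g →
    (∀ i → ¬ role V₁ V₂ (u , g i) ≡ role V₁ V₂ (v , g i)) →
    Σ (Matching T H t) λ M →
    ∀ k → ¬ role V₁ V₂ (proj₁ (edge M k)) ≡ role V₁ V₂ (proj₂ (edge M k))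
lemma1 {n} T H (connected , _) V V₁ V₂ _ _ u v t g g-injective u≁v =
  layeredMatching T H g g-injective (from ∘ change) (to ∘ change) (adjacent ∘ change) ,
  differ ∘ change
  where
  layerRole : Fin t → Fin n → Role
  layerRole k w = role V₁ V₂ (w , g k)

  change : ∀ k → BichromaticEdge T (layerRole k)
  change k = bichromaticEdgeOnWalk T _≟-role_ (layerRole k) (connected u v) (u≁v k)

  open BichromaticEdge
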